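{- For every integer $t$ there is a constant $n_t$ such that for every finite graph $G$ of twin-width at most $t$ and every non-empty set $A \subseteq V(G)$ we have $|N_G(A)| \le n_t |A|$.
   Context: Graphs are finite, undirected and simple. For $A \subseteq V(G)$ and $v \in V(G)$, $N_A(v) = \{u \in A : uv \in E(G)\}$, and $N_G(A) = \{N_A(v) : v \in V(G)\}$ is the set of distinct neighborhoods traced on $A$. Twin-width: a trigraph is a triple $(V,E,R)$ with $E,R$ disjoint sets of (black) edges and red edges on $V$; a graph $(V,E)$ is the trigraph $(V,E,\emptyset)$. Contracting two vertices $u,v$ of a trigraph yields a new vertex $w$ replacing $u,v$ (all other adjacencies unchanged) such that for each other vertex $x$: $wx$ is a black edge if $ux,vx$ are both black edges; $wx$ is not an edge at all if neither $ux$ nor $vx$ is a black edge (and, in the original definition, neither is red, i.e. $ux,vx$ both non-edges); and $wx$ is a red edge otherwise. A $d$-trigraph is one whose red graph has maximum degree at most $d$. The twin-width of $G$ is the least $d$ such that $G$ can be contracted to a single vertex by a sequence of contractions in which every intermediate trigraph is a $d$-trigraph. -}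

module Defs where

open import Data.Nat using (ℕ; _≤_)
open import Data.Bool using (Bool; true; false; if_then_else_; _∧_)
import Data.Bool.Properties as BoolP
open import Data.Fin using (Fin; _≟_)
open import Data.Fin.Subset using (Subset)
open import Data.Vec using (Vec; tabulate; lookup)
open import Data.Vec.Properties using (≡-dec)
open import Data.List using (List; length; filter; deduplicate; map; allFin)
open import Data.Product using (_×_)
open import Relation.Nullary using (¬_; does)
open import Relation.Binary.PropositionalEquality using (_≡_)

record Graph (n : ℕ) : Set where
  field
    adj   : Fin n → Fin n → Bool
    sym   : ∀ x y → adj x y ≡ adj y x
    irrefl : ∀ x → adj x x ≡ false
open Graph public

trace : ∀ {n} → Graph n → Subset n → Fin n → Subset n
trace G A v = tabulate (λ u → lookup A u ∧ adj G v u)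

-- |N_G(A)| : number of distinct traces N_A(v), v ∈ V(G)
numTraces : ∀ {n} → Graph n → Subset n → ℕ
numTraces {n} G A = length (deduplicate (≡-dec BoolP._≟_) (map (trace G A) (allFin n)))

-- Trigraphs.  The vertex set is the set of "alive" vertices of Fin n;
-- contracting u and v keeps the label u for the new vertex w and kills v.
data Colour : Set where
  none black red : Colour

record Trigraph (n : ℕ) : Set where
  field
    alive : Fin n → Bool
    col   : Fin n → Fin n → Colour
open Trigraph public

isRed : Colour → Bool
isRed red = true
isRed _   = false

merge : Colour → Colour → Colour
merge black black = black
merge none  none  = none
merge _     _     = red

eqᵇ : ∀ {n} → Fin n → Fin n → Bool
eqᵇ x y = does (x ≟ y)

contract : ∀ {n} → Trigraph n → Fin n → Fin n → Trigraph n
contract {n} T u v = record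
  { alive = λ x → if eqᵇ x v then false else alive T x
  ; col   = λ x y →
      if eqᵇ x u then (if eqᵇ y u then col T x y else merge (col T u y) (col T v y))
      else (if eqᵇ y u then merge (col T x u) (col T x v) else col T x y)
  }

aliveCount : ∀ {n} → Trigraph n → ℕ
aliveCount {n} T = length (filter (λ x → alive T x BoolP.≟ true) (allFin n))

redDegree : ∀ {n} → Trigraph n → Fin n → ℕ
redDegree {n} T x =
  length (filter (λ y → (alive T y ∧ (isRed (col T x y) ∧ Data.Bool.not (eqᵇ x y))) BoolP.≟ true) (allFin n))

IsDTrigraph : ∀ {n} → ℕ → Trigraph n → Set
IsDTrigraph {n} d T = ∀ x → alive T x ≡ true → redDegree T x ≤ d

data Contractible {n : ℕ} (d : ℕ) : Trigraph n → Set where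
  done : ∀ {T} → IsDTrigraph d T → aliveCount T ≡ 1 → Contractible d T
  step : ∀ {T} (u v : Fin n) → alive T u ≡ true → alive T v ≡ true → ¬ (u ≡ v) →
         IsDTrigraph d T → Contractible d (contract T u v) → Contractible d T

graphTrigraph : ∀ {n} → Graph n → Trigraph n
graphTrigraph G = record
  { alive = λ _ → true
  ; col   = λ x y → if adj G x y then black else none }

TwwAtMost : ∀ {n} → ℕ → Graph n → Set
TwwAtMost t G = Contractible t (graphTrigraph G)

{-# OPTIONS --safe #-}
module Submission where

-- Induction on |A|. If A has two vertices, follow the contraction sequence of G up to the
-- first contraction of two parts u, v that both contain vertices a₁, a₂ of A; until then
-- every part contains at most one vertex of A. A vertex with the same adjacency to a₁ and
-- a₂ has its trace on A determined by its trace on A - a₂. Any other vertex lies in u, in v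
-- or in a red neighbour of the merged part, and its trace is determined by its part and its
-- adjacency to the A-vertices of the at most (2 + d)(1 + d) parts within red distance one
-- of these 2 + d parts, since all other parts see it through black or non-edges. Hence
-- |N(A)| ≤ |N(A - a₂)| + (2 + d) 2^((2 + d)(1 + d)).

open import Defs
open import Data.Nat using (ℕ; zero; suc; _+_; _*_; _^_; _≤_; z≤n; s≤s)
open import Data.Nat.Properties
  using (≤-refl; ≤-trans; ≤-reflexive; +-mono-≤; +-monoˡ-≤; *-mono-≤; *-monoʳ-≤; *-monoˡ-≤;
         ^-monoʳ-≤; +-suc; +-comm; *-suc; *-distribʳ-+; m≤m+n; <-≤-trans; <⇒≱; ≤-pred;
         module ≤-Reasoning)
open import Data.Bool using (Bool; true; false; _∧_; not; if_then_else_)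
import Data.Bool.Properties as Bool
open import Data.Fin using (Fin; _≟_)
open import Data.Fin.Properties using (any?)
open import Data.Fin.Subset using (Subset; Nonempty; ∣_∣; _-_) renaming (_∈_ to _∈ˢ_)
open import Data.Fin.Subset.Properties
  using (nonempty?; x∈p∧x≢y⇒x∈p-y; x∈p⇒∣p-x∣<∣p∣) renaming (_∈?_ to _∈ˢ?_)
open import Data.Vec using (lookup)
open import Data.Vec.Properties using (tabulate-cong; lookup∘tabulate; ≡-dec; []=⇒lookup; lookup⇒[]=)
open import Data.List
  using (List; []; _∷_; [_]; length; filter; map; allFin; concatMap; cartesianProductWith;
         cartesianProduct; deduplicate)
open import Data.List.Properties using (length-++; length-map; length-removeAt′; ∷-injective)
open import Data.List.Membership.Propositional using (_∈_)
open import Data.List.Membership.Propositional.Properties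
  using (∈-filter⁺; ∈-filter⁻; ∈-allFin; ∈-map⁻; ∈-concatMap⁺; ∈-cartesianProductWith⁺)
import Data.List.Membership.DecPropositional as DecMembership
open import Data.List.Relation.Unary.Any as Any using (here; there)
open import Data.List.Relation.Unary.All as All using (All; []; _∷_)
open import Data.List.Relation.Unary.All.Properties as All using (all-filter; deduplicate⁺)
open import Data.List.Relation.Unary.AllPairs as AllPairs using (AllPairs; []; _∷_)
import Data.List.Relation.Unary.AllPairs.Properties as AllPairs
import Data.List.Relation.Unary.Unique.DecPropositional.Properties as UniqueDec
open import Data.Product using (∃; ∃₂; ∃-syntax; _×_; _,_; proj₁; proj₂)
open import Data.Sum using (_⊎_; inj₁; inj₂)
open import Data.Unit using (⊤; tt)
open import Data.Empty using (⊥-elim)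
open import Function using (_∘_; _on_)
open import Relation.Nullary using (¬_; Dec; yes; no; ¬?)
open import Relation.Nullary.Decidable using (_×-dec_; dec-true; dec-false; decidable-stable)
open import Relation.Unary using (Decidable)
open import Relation.Binary.PropositionalEquality as ≡
  using (_≡_; _≢_; refl; cong; cong₂; subst; ≢-sym)

module _ {X : Set} where

  ∈-─⁺ : ∀ {x y : X} {xs} (p : x ∈ xs) → y ∈ xs → y ≢ x → y ∈ (xs Any.─ p)
  ∈-─⁺ (here refl) (here refl) y≢x = ⊥-elim (y≢x refl)
  ∈-─⁺ (here refl) (there q)   _   = q
  ∈-─⁺ (there p)   (here refl) _   = here refl
  ∈-─⁺ (there p)   (there q)   y≢x = there (∈-─⁺ p q y≢x)

  length-filter-partition : ∀ {P : X → Set} (P? : Decidable P) xs →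
                            length xs ≡ length (filter P? xs) + length (filter (¬? ∘ P?) xs)
  length-filter-partition P? [] = refl
  length-filter-partition P? (x ∷ xs) with P? x
  ... | yes _ = cong suc (length-filter-partition P? xs)
  ... | no  _ = ≡.trans (cong suc (length-filter-partition P? xs)) (≡.sym (+-suc _ _))

  AllPairs-discharge : ∀ {P : X → Set} {S : X → X → Set} {xs} →
                       All P xs → AllPairs (λ x y → P x → P y → S x y) xs → AllPairs S xs
  AllPairs-discharge []         []       = []
  AllPairs-discharge (px ∷ pxs) (h ∷ hs) =
    All.zipWith (λ (py , Sxy) → Sxy px py) (pxs , h) ∷ AllPairs-discharge pxs hs

  length-concatMap-≤ : ∀ {Y : Set} (f : X → List Y) {k} xs → (∀ {x} → x ∈ xs → length (f x) ≤ k) →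
                       length (concatMap f xs) ≤ length xs * k
  length-concatMap-≤ f []       _     = z≤n
  length-concatMap-≤ f (x ∷ xs) short =
    ≤-trans (≤-reflexive (length-++ (f x)))
            (+-mono-≤ (short (here refl)) (length-concatMap-≤ f xs (short ∘ there)))

  ∈-length≡1 : ∀ {x y : X} xs → length xs ≡ 1 → x ∈ xs → y ∈ xs → x ≡ y
  ∈-length≡1 (_ ∷ []) _ (here refl) (here refl) = refl

  map-≡⇒≡ : ∀ {Y : Set} {f g : X → Y} {x} xs → map f xs ≡ map g xs → x ∈ xs → f x ≡ g x
  map-≡⇒≡ (_ ∷ _)  eq (here refl) = proj₁ (∷-injective eq)
  map-≡⇒≡ (_ ∷ xs) eq (there x∈)  = map-≡⇒≡ xs (proj₂ (∷-injective eq)) x∈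

module _ {X Y : Set} where

  length-≤-via-code : ∀ {Z : Set} (f : X → Y) (code : X → Z) {xs zs} →
                      AllPairs (_≢_ on f) xs →
                      (∀ {x y} → x ∈ xs → code x ≡ code y → f x ≡ f y) →
                      (∀ {x} → x ∈ xs → code x ∈ zs) →
                      length xs ≤ length zs
  length-≤-via-code f code []                      _          _      = z≤n
  length-≤-via-code f code {x ∷ xs} {zs} (fx≢ ∷ separated) determines codes∈ =
    ≤-trans (s≤s (length-≤-via-code f code separated (determines ∘ there) codes∈′))
            (≤-reflexive (≡.sym (length-removeAt′ zs (Any.index cx∈))))
    where
    cx∈ : code x ∈ zs
    cx∈ = codes∈ (here refl)
    codes∈′ : ∀ {y} → y ∈ xs → code y ∈ (zs Any.─ cx∈)
    codes∈′ y∈ = ∈-─⁺ cx∈ (codes∈ (there y∈))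
                       (λ eq → All.lookup fx≢ y∈ (≡.sym (determines (there y∈) eq)))

  map-preimage : ∀ (f : X → Y) {ys} → All (λ y → ∃ λ x → f x ≡ y) ys → ∃ λ xs → map f xs ≡ ys
  map-preimage f []               = [] , refl
  map-preimage f ((x , fx≡) ∷ ws) with xs , eq ← map-preimage f ws = x ∷ xs , cong₂ _∷_ fx≡ eq

  length-cartesianProductWith : ∀ {Z : Set} (g : X → Y → Z) xs ys →
                                length (cartesianProductWith g xs ys) ≡ length xs * length ys
  length-cartesianProductWith g []       ys = refl
  length-cartesianProductWith g (x ∷ xs) ys = ≡.trans (length-++ (map (g x) ys))
    (cong₂ _+_ (length-map (g x) ys) (length-cartesianProductWith g xs ys))

∈-bools : ∀ b → b ∈ true ∷ false ∷ []
∈-bools true  = here refl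
∈-bools false = there (here refl)

boolLists : ℕ → List (List Bool)
boolLists zero    = [ [] ]
boolLists (suc m) = cartesianProductWith _∷_ (true ∷ false ∷ []) (boolLists m)

length-boolLists : ∀ m → length (boolLists m) ≡ 2 ^ m
length-boolLists zero    = refl
length-boolLists (suc m) = ≡.trans (length-cartesianProductWith _∷_ (true ∷ false ∷ []) (boolLists m))
                                   (cong (2 *_) (length-boolLists m))

∈-boolLists : ∀ {m} bs → length bs ≡ m → bs ∈ boolLists m
∈-boolLists []       refl = here refl
∈-boolLists (b ∷ bs) refl = ∈-cartesianProductWith⁺ _∷_ (∈-bools b) (∈-boolLists bs refl)

module _ {n} (G : Graph n) where

  AgreeOn : Subset n → Fin n → Fin n → Set
  AgreeOn A x y = ∀ {w} → w ∈ˢ A → adj G x w ≡ adj G y w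

  agree⇒trace≡ : ∀ {A x y} → AgreeOn A x y → trace G A x ≡ trace G A y
  agree⇒trace≡ {A} {x} {y} agree = tabulate-cong pointwise
    where
    pointwise : ∀ w → (lookup A w ∧ adj G x w) ≡ (lookup A w ∧ adj G y w)
    pointwise w with lookup A w in w∈A
    ... | true  = agree (lookup⇒[]= w A w∈A)
    ... | false = refl

  trace≡⇒agree : ∀ {A x y} → trace G A x ≡ trace G A y → AgreeOn A x y
  trace≡⇒agree {A} {x} {y} eq {w} w∈A =
    subst (λ b → (b ∧ adj G x w) ≡ (b ∧ adj G y w)) ([]=⇒lookup w∈A)
      (≡.trans (≡.sym (lookup∘tabulate _ w)) (≡.trans (cong (λ t → lookup t w) eq) (lookup∘tabulate _ w)))

  trace≡-restore : ∀ {A a b x y} → a ∈ˢ A - b → adj G x a ≡ adj G x b → adj G y a ≡ adj G y b →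
                   trace G (A - b) x ≡ trace G (A - b) y → trace G A x ≡ trace G A y
  trace≡-restore {A} {b = b} {x} {y} a∈A-b xa≡xb ya≡yb eq = agree⇒trace≡ agree
    where
    agree : AgreeOn A x y
    agree {w} w∈A with w ≟ b
    ... | yes refl = ≡.trans (≡.sym xa≡xb) (≡.trans (trace≡⇒agree eq a∈A-b) ya≡yb)
    ... | no  w≢b  = trace≡⇒agree eq (x∈p∧x≢y⇒x∈p-y w∈A w≢b)

  numTraces-realised : ∀ A → ∃ λ xs → AllPairs (_≢_ on trace G A) xs × length xs ≡ numTraces G A
  numTraces-realised A
    with xs , eq ← map-preimage (trace G A) (deduplicate⁺ (≡-dec Bool._≟_)
                     (All.map⁺ (All.universal (λ x → x , refl) (allFin n))))
    = xs , separated , ≡.trans (≡.sym (length-map (trace G A) xs)) (cong length eq)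
    where
    separated : AllPairs (_≢_ on trace G A) xs
    separated = AllPairs.map⁻ (subst (AllPairs _≢_) (≡.sym eq)
                  (UniqueDec.deduplicate-! (≡-dec Bool._≟_) (map (trace G A) (allFin n))))

-- Trigraphs as quotients of a graph

eqᵇ-refl : ∀ {n} (x : Fin n) → eqᵇ x x ≡ true
eqᵇ-refl x = dec-true (x ≟ x) refl

eqᵇ-≢ : ∀ {n} {x y : Fin n} → x ≢ y → eqᵇ x y ≡ false
eqᵇ-≢ {x = x} {y} = dec-false (x ≟ y)

module _ {n} (T : Trigraph n) (u v : Fin n) where

  col-contract-uq : ∀ {q} → q ≢ u → col (contract T u v) u q ≡ merge (col T u q) (col T v q)
  col-contract-uq q≢u rewrite eqᵇ-refl u | eqᵇ-≢ q≢u = refl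

  col-contract-pu : ∀ {p} → p ≢ u → col (contract T u v) p u ≡ merge (col T p u) (col T p v)
  col-contract-pu p≢u rewrite eqᵇ-refl u | eqᵇ-≢ p≢u = refl

  alive-contract⁺ : ∀ {x} → x ≢ v → alive T x ≡ true → alive (contract T u v) x ≡ true
  alive-contract⁺ x≢v x-alive rewrite eqᵇ-≢ x≢v = x-alive

  alive-contract⁻ : ∀ {x} → alive (contract T u v) x ≡ true → alive T x ≡ true
  alive-contract⁻ {x} x-alive with eqᵇ x v
  ... | false = x-alive

redirect : ∀ {n} → Fin n → Fin n → Fin n → Fin n
redirect u v p = if eqᵇ p v then u else p

redirect-target : ∀ {n} (u : Fin n) {v p} → p ≡ v → redirect u v p ≡ u
redirect-target u {p = p} refl rewrite eqᵇ-refl p = refl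

redirect-other : ∀ {n} (u : Fin n) {v p} → p ≢ v → redirect u v p ≡ p
redirect-other u p≢v rewrite eqᵇ-≢ p≢v = refl

redirect-≡ : ∀ {n} {u v p q : Fin n} → redirect u v p ≡ redirect u v q →
             p ≡ q ⊎ (p ≡ v × q ≡ u) ⊎ (p ≡ u × q ≡ v)
redirect-≡ {u = u} {v} {p} {q} eq = cases (p ≟ v) (q ≟ v)
  where
  cases : Dec (p ≡ v) → Dec (q ≡ v) → p ≡ q ⊎ (p ≡ v × q ≡ u) ⊎ (p ≡ u × q ≡ v)
  cases (yes p≡v) (yes q≡v) = inj₁ (≡.trans p≡v (≡.sym q≡v))
  cases (yes p≡v) (no  q≢v) = inj₂ (inj₁ (p≡v , ≡.trans (≡.sym (redirect-other u q≢v))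
                                             (≡.trans (≡.sym eq) (redirect-target u p≡v))))
  cases (no  p≢v) (yes q≡v) = inj₂ (inj₂ (≡.trans (≡.sym (redirect-other u p≢v))
                                             (≡.trans eq (redirect-target u q≡v)) , q≡v))
  cases (no  p≢v) (no  q≢v) = inj₁ (≡.trans (≡.sym (redirect-other u p≢v))
                                             (≡.trans eq (redirect-other u q≢v)))

Compatible : Colour → Bool → Set
Compatible black b = b ≡ true
Compatible none  b = b ≡ false
Compatible red   _ = ⊤

Compatible-mergeˡ : ∀ c₁ c₂ {b} → Compatible c₁ b → Compatible (merge c₁ c₂) b
Compatible-mergeˡ none  none  h = h
Compatible-mergeˡ black black h = h
Compatible-mergeˡ none  black _ = tt
Compatible-mergeˡ none  red   _ = tt
Compatible-mergeˡ black none  _ = tt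
Compatible-mergeˡ black red   _ = tt
Compatible-mergeˡ red   _     _ = tt

Compatible-mergeʳ : ∀ c₁ c₂ {b} → Compatible c₂ b → Compatible (merge c₁ c₂) b
Compatible-mergeʳ none  none  h = h
Compatible-mergeʳ black black h = h
Compatible-mergeʳ red   _     _ = tt
Compatible-mergeʳ black none  _ = tt
Compatible-mergeʳ black red   _ = tt
Compatible-mergeʳ none  black _ = tt
Compatible-mergeʳ none  red   _ = tt

Compatible-unique : ∀ {c b₁ b₂} → isRed c ≢ true → Compatible c b₁ → Compatible c b₂ → b₁ ≡ b₂
Compatible-unique {none}  _       h₁ h₂ = ≡.trans h₁ (≡.sym h₂)
Compatible-unique {black} _       h₁ h₂ = ≡.trans h₁ (≡.sym h₂)
Compatible-unique {red}   non-red _  _  = ⊥-elim (non-red refl)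

-- r x is the vertex of T into which the vertex x of G has been contracted.
record IsQuotient {n} (G : Graph n) (r : Fin n → Fin n) (T : Trigraph n) : Set where
  field
    part-alive : ∀ x → alive T (r x) ≡ true
    part-col   : ∀ x y → r x ≢ r y → Compatible (col T (r x) (r y)) (adj G x y)

  part-col-at : ∀ {x y p q} → r x ≡ p → r y ≡ q → p ≢ q → Compatible (col T p q) (adj G x y)
  part-col-at refl refl = part-col _ _

open IsQuotient

graph-isQuotient : ∀ {n} (G : Graph n) → IsQuotient G (λ x → x) (graphTrigraph G)
graph-isQuotient G = record { part-alive = λ _ → refl ; part-col = λ x y _ → compatible (adj G x y) }
  where
  compatible : ∀ b → Compatible (if b then black else none) b
  compatible true  = refl
  compatible false = refl

module _ {n} {T : Trigraph n} {u v : Fin n} where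

  Compatible-contract : ∀ p q {b} → redirect u v p ≢ redirect u v q → Compatible (col T p q) b →
                        Compatible (col (contract T u v) (redirect u v p) (redirect u v q)) b
  Compatible-contract p q p′≢q′ h with p ≟ v | q ≟ v
  ... | yes refl | yes refl = ⊥-elim (p′≢q′ refl)
  ... | yes refl | no q≢v rewrite col-contract-uq T u v (≢-sym p′≢q′) = Compatible-mergeʳ _ _ h
  ... | no p≢v | yes refl rewrite col-contract-pu T u v p′≢q′ = Compatible-mergeʳ _ _ h
  ... | no p≢v | no q≢v with p ≟ u | q ≟ u
  ...   | yes refl | yes refl = ⊥-elim (p′≢q′ refl)
  ...   | yes refl | no _    = Compatible-mergeˡ _ _ h
  ...   | no _    | yes refl = Compatible-mergeˡ _ _ h
  ...   | no _    | no _     = h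

  contract-isQuotient : ∀ {G : Graph n} {r} → IsQuotient G r T → alive T u ≡ true → u ≢ v →
                        IsQuotient G (redirect u v ∘ r) (contract T u v)
  contract-isQuotient {G} {r} Q u-alive u≢v = record { part-alive = alive′ ; part-col = col′ }
    where
    alive′ : ∀ x → alive (contract T u v) (redirect u v (r x)) ≡ true
    alive′ x with r x ≟ v
    ... | yes _    = alive-contract⁺ T u v u≢v u-alive
    ... | no  rx≢v = alive-contract⁺ T u v rx≢v (part-alive Q x)
    col′ : ∀ x y → redirect u v (r x) ≢ redirect u v (r y) →
           Compatible (col (contract T u v) (redirect u v (r x)) (redirect u v (r y))) (adj G x y)
    col′ x y rx′≢ry′ =
      Compatible-contract (r x) (r y) rx′≢ry′ (part-col Q x y (rx′≢ry′ ∘ cong (redirect u v)))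

redNeighbours : ∀ {n} → Trigraph n → Fin n → List (Fin n)
redNeighbours {n} T x =
  filter (λ y → (alive T y ∧ (isRed (col T x y) ∧ not (eqᵇ x y))) Bool.≟ true) (allFin n)

module _ {n} (T : Trigraph n) where

  ∈-redNeighbours⁺ : ∀ {x y} → alive T y ≡ true → isRed (col T x y) ≡ true → x ≢ y → y ∈ redNeighbours T x
  ∈-redNeighbours⁺ {x} {y} y-alive xy-red x≢y =
    ∈-filter⁺ _ (∈-allFin y) (cong₂ _∧_ y-alive (cong₂ _∧_ xy-red (cong not (eqᵇ-≢ x≢y))))

  ∈-redNeighbours⁻ : ∀ {x y} → y ∈ redNeighbours T x → alive T y ≡ true
  ∈-redNeighbours⁻ {x} {y} y∈ = Bool.∧-conicalˡ _ _ (proj₂ (∈-filter⁻ _ {xs = allFin n} y∈))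

  aliveCount≡1⇒≡ : aliveCount T ≡ 1 → ∀ {p q} → alive T p ≡ true → alive T q ≡ true → p ≡ q
  aliveCount≡1⇒≡ single p-alive q-alive =
    ∈-length≡1 _ single (∈-filter⁺ _ (∈-allFin _) p-alive) (∈-filter⁺ _ (∈-allFin _) q-alive)

isDTrigraph : ∀ {n d} {T : Trigraph n} → Contractible d T → IsDTrigraph d T
isDTrigraph (done bounded _)           = bounded
isDTrigraph (step _ _ _ _ _ bounded _) = bounded

-- The first contraction merging two parts that meet A

module _ {n} (A : Subset n) where

  InjectiveOn : (Fin n → Fin n) → Set
  InjectiveOn r = ∀ {a b} → a ∈ˢ A → b ∈ˢ A → r a ≡ r b → a ≡ b

  Hit : (Fin n → Fin n) → Fin n → Set
  Hit r p = ∃ λ a → a ∈ˢ A × r a ≡ p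

  hit? : ∀ r p → Dec (Hit r p)
  hit? r p = any? λ a → (a ∈ˢ? A) ×-dec (r a ≟ p)

  redirect-injectiveOn : ∀ {r u v} → InjectiveOn r → ¬ (Hit r u × Hit r v) → InjectiveOn (redirect u v ∘ r)
  redirect-injectiveOn inj unhit {a} {b} a∈A b∈A eq with redirect-≡ eq
  ... | inj₁ ra≡rb                = inj a∈A b∈A ra≡rb
  ... | inj₂ (inj₁ (ra≡v , rb≡u)) = ⊥-elim (unhit ((b , b∈A , rb≡u) , (a , a∈A , ra≡v)))
  ... | inj₂ (inj₂ (ra≡u , rb≡v)) = ⊥-elim (unhit ((a , a∈A , ra≡u) , (b , b∈A , rb≡v)))

module _ {n} (d : ℕ) (G : Graph n) (A : Subset n) where

  record Collision : Set where
    field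
      T                : Trigraph n
      r                : Fin n → Fin n
      u v              : Fin n
      quotient         : IsQuotient G r T
      r-injective      : InjectiveOn A r
      T-bounded        : IsDTrigraph d T
      contract-bounded : IsDTrigraph d (contract T u v)
      u-alive          : alive T u ≡ true
      v-alive          : alive T v ≡ true
      u≢v              : u ≢ v
      a₁ a₂            : Fin n
      a₁∈A             : a₁ ∈ˢ A
      a₂∈A             : a₂ ∈ˢ A
      r-a₁             : r a₁ ≡ u
      r-a₂             : r a₂ ≡ v

  find-collision : ∀ {T r} → Contractible d T → IsQuotient G r T → InjectiveOn A r →
                   ∀ {a b} → a ∈ˢ A → b ∈ˢ A → a ≢ b → Collision
  find-collision {T} (done _ single) Q inj a∈A b∈A a≢b =
    ⊥-elim (a≢b (inj a∈A b∈A (aliveCount≡1⇒≡ T single (part-alive Q _) (part-alive Q _))))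
  find-collision {T} {r} (step u v u-alive v-alive u≢v T-bounded rest) Q inj a∈A b∈A a≢b
    with hit? A r u | hit? A r v
  ... | yes (a₁ , a₁∈A , r-a₁) | yes (a₂ , a₂∈A , r-a₂) = record
    { T = T ; r = r ; u = u ; v = v ; quotient = Q ; r-injective = inj
    ; T-bounded = T-bounded ; contract-bounded = isDTrigraph rest
    ; u-alive = u-alive ; v-alive = v-alive ; u≢v = u≢v
    ; a₁ = a₁ ; a₂ = a₂ ; a₁∈A = a₁∈A ; a₂∈A = a₂∈A ; r-a₁ = r-a₁ ; r-a₂ = r-a₂ }
  ... | no u-unhit | _ = find-collision rest (contract-isQuotient Q u-alive u≢v)
                           (redirect-injectiveOn A inj (u-unhit ∘ proj₁)) a∈A b∈A a≢b
  ... | yes _ | no v-unhit = find-collision rest (contract-isQuotient Q u-alive u≢v)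
                               (redirect-injectiveOn A inj (v-unhit ∘ proj₂)) a∈A b∈A a≢b

-- Vertices distinguishing the two colliding vertices of A

distinguishedBound : ℕ → ℕ
distinguishedBound d = (2 + d) * 2 ^ ((2 + d) * suc d)

module Distinguishing {n d} {G : Graph n} {A : Subset n} (C : Collision d G A) where
  open Collision C
  open DecMembership (_≟_ {n}) using (_∈?_)

  Distinguishes : Fin n → Set
  Distinguishes x = adj G x a₁ ≢ adj G x a₂

  T′ : Trigraph n
  T′ = contract T u v

  quotient′ : IsQuotient G (redirect u v ∘ r) T′
  quotient′ = contract-isQuotient quotient u-alive u≢v

  parts : List (Fin n)
  parts = u ∷ v ∷ redNeighbours T′ u

  near : List (Fin n)
  near = concatMap (λ p → p ∷ redNeighbours T p) parts

  ∈-near : ∀ {p q} → p ∈ parts → q ∈ p ∷ redNeighbours T p → q ∈ near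
  ∈-near p∈ q∈ = ∈-concatMap⁺ (λ p → p ∷ redNeighbours T p) (Any.map (λ { refl → q∈ }) p∈)

  parts-alive : ∀ {p} → p ∈ parts → alive T p ≡ true
  parts-alive (here refl)         = u-alive
  parts-alive (there (here refl)) = v-alive
  parts-alive (there (there p∈))  = alive-contract⁻ T u v (∈-redNeighbours⁻ T′ {u} p∈)

  length-parts : length parts ≤ 2 + d
  length-parts = s≤s (s≤s (contract-bounded u (alive-contract⁺ T u v u≢v u-alive)))

  length-near : length near ≤ (2 + d) * suc d
  length-near =
    ≤-trans (length-concatMap-≤ (λ p → p ∷ redNeighbours T p) parts (s≤s ∘ T-bounded _ ∘ parts-alive))
            (*-monoˡ-≤ (suc d) length-parts)

  -- In T′ both a₁ and a₂ lie in the merged part u, so the colour from u to the part of a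
  -- distinguishing vertex is red.
  part∈parts : ∀ {x} → Distinguishes x → r x ∈ parts
  part∈parts {x} distinguishes with r x ≟ u | r x ≟ v
  ... | yes rx≡u | _        = here rx≡u
  ... | no  _    | yes rx≡v = there (here rx≡v)
  ... | no  rx≢u | no  rx≢v = there (there (∈-redNeighbours⁺ T′ {u} x-alive′ red′ (≢-sym rx≢u)))
    where
    r′x≡rx : redirect u v (r x) ≡ r x
    r′x≡rx = redirect-other u rx≢v
    r′a₁≡u : redirect u v (r a₁) ≡ u
    r′a₁≡u = ≡.trans (redirect-other u (λ ra₁≡v → u≢v (≡.trans (≡.sym r-a₁) ra₁≡v))) r-a₁
    x-alive′ : alive T′ (r x) ≡ true
    x-alive′ = subst (λ p → alive T′ p ≡ true) r′x≡rx (part-alive quotient′ x)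
    compatible₁ : Compatible (col T′ u (r x)) (adj G a₁ x)
    compatible₁ = part-col-at quotient′ r′a₁≡u r′x≡rx (≢-sym rx≢u)
    compatible₂ : Compatible (col T′ u (r x)) (adj G a₂ x)
    compatible₂ = part-col-at quotient′ (redirect-target u r-a₂) r′x≡rx (≢-sym rx≢u)
    red′ : isRed (col T′ u (r x)) ≡ true
    red′ = decidable-stable (isRed _ Bool.≟ true) λ non-red →
      distinguishes (≡.trans (Graph.sym G x a₁)
        (≡.trans (Compatible-unique non-red compatible₁ compatible₂) (Graph.sym G a₂ x)))

  adjToPart : Fin n → Fin n → Bool
  adjToPart q x with hit? A r q
  ... | yes (a , _) = adj G x a
  ... | no  _       = false

  adjToPart-spec : ∀ {a q} → a ∈ˢ A → r a ≡ q → ∀ x → adjToPart q x ≡ adj G x a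
  adjToPart-spec {a} {q} a∈A ra≡q x with hit? A r q
  ... | yes (a′ , a′∈A , ra′≡q) = cong (adj G x) (r-injective a′∈A a∈A (≡.trans ra′≡q (≡.sym ra≡q)))
  ... | no  unhit                = ⊥-elim (unhit (a , a∈A , ra≡q))

  code : Fin n → Fin n × List Bool
  code x = r x , map (λ q → adjToPart q x) near

  codes : List (Fin n × List Bool)
  codes = cartesianProduct parts (boolLists (length near))

  code∈codes : ∀ {x} → Distinguishes x → code x ∈ codes
  code∈codes distinguishes =
    ∈-cartesianProductWith⁺ _,_ (part∈parts distinguishes) (∈-boolLists _ (length-map _ near))

  code-determines : ∀ {x y} → Distinguishes x → code x ≡ code y → trace G A x ≡ trace G A y
  code-determines {x} {y} distinguishes eq = agree⇒trace≡ G agree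
    where
    rx≡ry : r x ≡ r y
    rx≡ry = cong proj₁ eq
    rx∈parts : r x ∈ parts
    rx∈parts = part∈parts distinguishes
    agree : AgreeOn G A x y
    agree {w} w∈A with r w ∈? near
    ... | yes rw∈near = begin
      adj G x w         ≡⟨ ≡.sym (adjToPart-spec w∈A refl x) ⟩
      adjToPart (r w) x ≡⟨ map-≡⇒≡ near (cong proj₂ eq) rw∈near ⟩
      adjToPart (r w) y ≡⟨ adjToPart-spec w∈A refl y ⟩
      adj G y w         ∎
      where open ≡.≡-Reasoning
    ... | no rw∉near = Compatible-unique non-red (part-col-at quotient refl refl rx≢rw)
                                                 (part-col-at quotient (≡.sym rx≡ry) refl rx≢rw)
      where
      rx≢rw : r x ≢ r w
      rx≢rw rx≡rw = rw∉near (∈-near rx∈parts (here (≡.sym rx≡rw)))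
      non-red : isRed (col T (r x) (r w)) ≢ true
      non-red is-red =
        rw∉near (∈-near rx∈parts (there (∈-redNeighbours⁺ T (part-alive quotient w) is-red rx≢rw)))

  length-≤-distinguishedBound : ∀ {xs} → AllPairs (_≢_ on trace G A) xs → All Distinguishes xs →
                                length xs ≤ distinguishedBound d
  length-≤-distinguishedBound {xs} separated distinguish = begin
    length xs
      ≤⟨ length-≤-via-code (trace G A) code separated (code-determines ∘ All.lookup distinguish)
                                                       (code∈codes ∘ All.lookup distinguish) ⟩
    length codes
      ≡⟨ length-cartesianProductWith _,_ parts (boolLists (length near)) ⟩
    length parts * length (boolLists (length near))
      ≡⟨ cong (length parts *_) (length-boolLists (length near)) ⟩
    length parts * 2 ^ length near
      ≤⟨ *-mono-≤ length-parts (^-monoʳ-≤ 2 length-near) ⟩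
    distinguishedBound d ∎
    where open ≤-Reasoning

-- Counting traces

TwoElements : ∀ {n} → Subset n → Set
TwoElements A = ∃₂ λ a b → a ∈ˢ A × b ∈ˢ A × a ≢ b

two-elements? : ∀ {n} (A : Subset n) → Dec (TwoElements A)
two-elements? A = any? λ a → any? λ b → (a ∈ˢ? A) ×-dec ((b ∈ˢ? A) ×-dec ¬? (a ≟ b))

module _ {n} (G : Graph n) where

  length-separated-≤-2 : ∀ {A xs} → ¬ TwoElements A → AllPairs (_≢_ on trace G A) xs → length xs ≤ 2
  length-separated-≤-2 {A} small separated with nonempty? A
  ... | yes (a₀ , a₀∈A) = length-≤-via-code (trace G A) (λ x → adj G x a₀) separated
      (λ {x} {y} _ eq → agree⇒trace≡ G λ w∈A →
        subst (λ w → adj G x w ≡ adj G y w) (≡.sym (only w∈A a₀∈A)) eq)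
      (λ _ → ∈-bools _)
    where
    only : ∀ {a b} → a ∈ˢ A → b ∈ˢ A → a ≡ b
    only {a} {b} a∈A b∈A = decidable-stable (a ≟ b) λ a≢b → small (a , b , a∈A , b∈A , a≢b)
  ... | no empty = length-≤-via-code (trace G A) (λ _ → true) separated
      (λ _ _ → agree⇒trace≡ G {A} λ w∈A → ⊥-elim (empty (_ , w∈A)))
      (λ _ → ∈-bools true)

module _ {n d} {G : Graph n} (tww : TwwAtMost d G) where

  collision : ∀ {A} → TwoElements A → Collision d G A
  collision (a , b , a∈A , b∈A , a≢b) =
    find-collision d G _ tww (graph-isQuotient G) (λ _ _ eq → eq) a∈A b∈A a≢b

  length-separated-≤ : ∀ k {A xs} → ∣ A ∣ ≤ k → AllPairs (_≢_ on trace G A) xs →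
                       length xs ≤ 2 + distinguishedBound d * k
  length-separated-≤ k {A} _ separated with two-elements? A
  ... | no small = ≤-trans (length-separated-≤-2 G small separated) (m≤m+n 2 _)
  length-separated-≤ zero ∣A∣≤0 _ | yes (a , _ , a∈A , _) =
    ⊥-elim (<⇒≱ (<-≤-trans (x∈p⇒∣p-x∣<∣p∣ a∈A) ∣A∣≤0) z≤n)
  length-separated-≤ (suc k) {A} {xs} ∣A∣≤1+k separated | yes two = begin
    length xs
      ≡⟨ length-filter-partition agrees? xs ⟩
    length (filter agrees? xs) + length (filter (¬? ∘ agrees?) xs)
      ≤⟨ +-mono-≤ (length-separated-≤ k {A - a₂} ∣A-a₂∣≤k separated-agreeing)
                  (length-≤-distinguishedBound (AllPairs.filter⁺ (¬? ∘ agrees?) separated)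
                                               (all-filter (¬? ∘ agrees?) xs)) ⟩
    2 + K * k + K
      ≡⟨ cong (2 +_) (≡.trans (+-comm (K * k) K) (≡.sym (*-suc K k))) ⟩
    2 + K * suc k ∎
    where
    open ≤-Reasoning
    open Collision (collision two)
    open Distinguishing (collision two)
    K : ℕ
    K = distinguishedBound d
    agrees? : ∀ x → Dec (adj G x a₁ ≡ adj G x a₂)
    agrees? x = adj G x a₁ Bool.≟ adj G x a₂
    ∣A-a₂∣≤k : ∣ A - a₂ ∣ ≤ k
    ∣A-a₂∣≤k = ≤-pred (<-≤-trans (x∈p⇒∣p-x∣<∣p∣ a₂∈A) ∣A∣≤1+k)
    a₁∈A-a₂ : a₁ ∈ˢ A - a₂
    a₁∈A-a₂ = x∈p∧x≢y⇒x∈p-y a₁∈A λ a₁≡a₂ → u≢v (≡.trans (≡.sym r-a₁) (≡.trans (cong r a₁≡a₂) r-a₂))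
    separated-agreeing : AllPairs (_≢_ on trace G (A - a₂)) (filter agrees? xs)
    separated-agreeing = AllPairs-discharge (all-filter agrees? xs) (AllPairs.filter⁺ agrees?
      (AllPairs.map (λ tx≢ty x-agrees y-agrees → tx≢ty ∘ trace≡-restore G a₁∈A-a₂ x-agrees y-agrees)
                    separated))

  numTraces-≤ : ∀ A → numTraces G A ≤ 2 + distinguishedBound d * ∣ A ∣
  numTraces-≤ A with xs , separated , length≡ ← numTraces-realised G A =
    subst (_≤ _) length≡ (length-separated-≤ ∣ A ∣ {A} ≤-refl separated)

theorem1 : ∀ (t : ℕ) → ∃[ c ] (∀ (n : ℕ) (G : Graph n) → TwwAtMost t G →
             ∀ (A : Subset n) → Nonempty A → numTraces G A ≤ c * ∣ A ∣)
theorem1 t = 2 + K , λ n G tww A (a , a∈A) → begin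
  numTraces G A       ≤⟨ numTraces-≤ {G = G} tww A ⟩
  2 + K * ∣ A ∣       ≤⟨ +-monoˡ-≤ (K * ∣ A ∣) (*-monoʳ-≤ 2 (≤-trans (s≤s z≤n) (x∈p⇒∣p-x∣<∣p∣ a∈A))) ⟩
  2 * ∣ A ∣ + K * ∣ A ∣ ≡⟨ ≡.sym (*-distribʳ-+ ∣ A ∣ 2 K) ⟩
  (2 + K) * ∣ A ∣     ∎
  where
  open ≤-Reasoning
  K : ℕ
  K = distinguishedBound t
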